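{- Let $B = (\epsilon_1; \ell_1, \ldots, \ell_n)$ be a block decomposition and $1 \leq j \leq k \leq n$ with $\rho_{j,k} B = B$. Then $B^{\mathrm{len}}_{k-i} = B^{\mathrm{len}}_{j+i}$ for $0 \leq i \leq k-j$. Moreover, if $k - j + 1$ is even, or if $k-j+1$ is odd and $B^{\mathrm{len}}_{j + (k-j)/2}$ is odd, then $B^{\mathrm{st}}_j = B^{\mathrm{en}}_k$.
   Context: For $\epsilon \in \{0,1\}$, $W_\epsilon^\ell$ is the alternating word of length $\ell$ over $\{0,1\}$ starting with $\epsilon$. A block decomposition $B = (\epsilon_1; \ell_1, \ldots, \ell_n)$ ($\ell_i \geq 1$) has word $W_{\epsilon_1}^{\ell_1}\cdots W_{\epsilon_n}^{\ell_n}$ with $\epsilon_{i+1} \equiv \epsilon_i + \ell_i - 1 \pmod 2$. For the $i$-th block, $B^{\mathrm{len}}_i = \ell_i$ is its length, $B^{\mathrm{st}}_i = \epsilon_i$ its first letter, and $B^{\mathrm{en}}_i$ its last letter. The reflection $\rho_{j,k}$ maps $B$ to $(\epsilon_1; \ell'_1, \ldots, \ell'_n)$ with $\ell'_i = \ell_i$ for $i<j$ or $i>k$ and $\ell'_i = \ell_{k+j-i}$ for $j \le i \le k$. -}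

module Defs where

open import Data.Nat using (ℕ; zero; suc; _+_; _∸_; _≤_; _<_; _≤ᵇ_)
open import Data.Nat.DivMod using (_%_)
open import Data.Bool using (Bool; true; false; if_then_else_; _∧_)
open import Data.List using (List; []; _∷_; length; map; upTo)
open import Data.List.Relation.Unary.All using (All)
open import Data.Product using (_×_)
open import Relation.Binary.PropositionalEquality using (_≡_)

-- Raw block decomposition (ε₁; ℓ₁, …, ℓₙ): first letter ε₁ and the list of
-- block lengths [ℓ₁, …, ℓₙ].  Letters 0,1 are natural numbers.
record BlockDecomp : Set where
  constructor bd
  field
    ε₁   : ℕ
    lens : List ℕ
open BlockDecomp public

Valid : BlockDecomp → Set
Valid B = (ε₁ B < 2) × All (1 ≤_) (lens B)

nB : BlockDecomp → ℕ
nB B = length (lens B)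

-- 1-indexed lookup (0 outside the range 1..length)
nth : List ℕ → ℕ → ℕ
nth []       _             = 0
nth (x ∷ xs) zero          = 0
nth (x ∷ xs) (suc zero)    = x
nth (x ∷ xs) (suc (suc i)) = nth xs (suc i)

-- first letter of the i-th block (1-indexed), via ε_{i+1} ≡ ε_i + ℓ_i - 1 (mod 2)
startAux : ℕ → List ℕ → ℕ → ℕ
startAux e []       _             = e
startAux e (l ∷ ls) zero          = e
startAux e (l ∷ ls) (suc zero)    = e
startAux e (l ∷ ls) (suc (suc i)) = startAux ((e + l ∸ 1) % 2) ls (suc i)

len : BlockDecomp → ℕ → ℕ
len B i = nth (lens B) i

st : BlockDecomp → ℕ → ℕ
st B i = startAux (ε₁ B) (lens B) i

-- B^en_i : last letter of the alternating word W_{ε_i}^{ℓ_i}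
en : BlockDecomp → ℕ → ℕ
en B i = (st B i + len B i ∸ 1) % 2

ρ : ℕ → ℕ → BlockDecomp → BlockDecomp
ρ j k B = bd (ε₁ B)
  (map (λ m → let i = suc m in
               if (j ≤ᵇ i) ∧ (i ≤ᵇ k) then len B (k + j ∸ i) else len B i)
       (upTo (nB B)))

Even : ℕ → Set
Even m = m % 2 ≡ 0

Odd : ℕ → Set
Odd m = m % 2 ≡ 1

-- Blocks are separated by a repeated letter and inside a block of length ℓ
-- the letter flips ℓ − 1 times, so the last letter of block k is the first
-- letter of block j shifted by Σ_{i=j}^{k} (ℓᵢ − 1) modulo 2.  Invariance
-- under ρ_{j,k} says that ℓ_j, …, ℓ_k is a palindrome; the sum of a
-- palindrome of even length is twice the sum of its first half, and for odd
-- length the middle term is added, which is even when the middle block has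
-- odd length.
module Submission where

open import Defs
open import Data.Nat using (ℕ; zero; suc; _+_; _*_; _∸_; _≤_; _<_; _≤ᵇ_; z≤n; s≤s; NonZero)
open import Data.Nat.Properties
open import Data.Nat.DivMod using (_%_; _/_; m≡m%n+[m/n]*n; m%n%n≡m%n; m%n<n; m<n⇒m%n≡m; %-distribˡ-+; %-remove-+ˡ; %-remove-+ʳ)
open import Data.Nat.Divisibility using (m∣m*n; m%n≡0⇒n∣m)
open import Data.Nat.Tactic.RingSolver using (solve-∀)
open import Data.Bool using (true; if_then_else_; _∧_)
open import Data.Bool.Properties using (T-≡)
open import Data.List using (List; []; _∷_; length; map; applyUpTo)
open import Data.List.Relation.Unary.All using (All; _∷_)
open import Data.Product using (_×_; _,_)
open import Data.Sum using (_⊎_; inj₁; inj₂)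
import Data.Sum as Sum
import Data.Product as Product
open import Function using (_∘_; id)
open import Function.Bundles using (Equivalence)
open import Relation.Binary.PropositionalEquality using (_≡_; refl; sym; trans; cong; cong₂; subst; module ≡-Reasoning)

open ≡-Reasoning

[m%d+n]%d≡[m+n]%d : ∀ m n d .{{_ : NonZero d}} → (m % d + n) % d ≡ (m + n) % d
[m%d+n]%d≡[m+n]%d m n d = begin
  (m % d + n) % d           ≡⟨ %-distribˡ-+ (m % d) n d ⟩
  (m % d % d + n % d) % d   ≡⟨ cong (λ r → (r + n % d) % d) (m%n%n≡m%n m d) ⟩
  (m % d + n % d) % d       ≡⟨ %-distribˡ-+ m n d ⟨
  (m + n) % d               ∎

even⇒≡half+half : ∀ n → Even n → n ≡ n / 2 + n / 2
even⇒≡half+half n even = begin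
  n                   ≡⟨ m≡m%n+[m/n]*n n 2 ⟩
  n % 2 + n / 2 * 2   ≡⟨ cong (_+ n / 2 * 2) even ⟩
  n / 2 * 2           ≡⟨ *-comm (n / 2) 2 ⟩
  n / 2 + (n / 2 + 0) ≡⟨ cong (n / 2 +_) (+-identityʳ (n / 2)) ⟩
  n / 2 + n / 2       ∎

odd⇒pred-even : ∀ n → Odd n → Even (n ∸ 1)
odd⇒pred-even (suc n) odd = remainder (m%n<n n 2) (trans (sym (%-distribˡ-+ 1 n 2)) odd)
  where
  remainder : ∀ {r} → r < 2 → suc r % 2 ≡ 1 → r ≡ 0
  remainder {0}           _              _  = refl
  remainder {1}           _              ()
  remainder {suc (suc _)} (s≤s (s≤s ())) _

sumFrom : (ℕ → ℕ) → ℕ → ℕ → ℕ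
sumFrom f a zero    = 0
sumFrom f a (suc c) = f a + sumFrom f (suc a) c

sumFrom-last : ∀ f a c → sumFrom f a (suc c) ≡ sumFrom f a c + f (a + c)
sumFrom-last f a zero    = trans (+-identityʳ (f a)) (cong f (sym (+-identityʳ a)))
sumFrom-last f a (suc c) = begin
  f a + sumFrom f (suc a) (suc c)               ≡⟨ cong (f a +_) (sumFrom-last f (suc a) c) ⟩
  f a + (sumFrom f (suc a) c + f (suc a + c))   ≡⟨ +-assoc (f a) _ _ ⟨
  f a + sumFrom f (suc a) c + f (suc a + c)     ≡⟨ cong (λ x → f a + sumFrom f (suc a) c + f x) (+-suc a c) ⟨
  f a + sumFrom f (suc a) c + f (a + suc c)     ∎

-- a + i and a + i′ are mirror positions in the window a, …, a + c − 1.
Palindromic : (ℕ → ℕ) → ℕ → ℕ → Set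
Palindromic f a c = ∀ i i′ → i + suc i′ ≡ c → f (a + i) ≡ f (a + i′)

Palindromic-map : ∀ g f a {c} → Palindromic f a c → Palindromic (g ∘ f) a c
Palindromic-map g f a pal i i′ eq = cong g (pal i i′ eq)

Palindromic-reverse : ∀ f a {d i} → Palindromic f a (suc d) → i ≤ d → f (a + d ∸ i) ≡ f (a + i)
Palindromic-reverse f a {d} {i} pal i≤d = begin
  f (a + d ∸ i)     ≡⟨ cong f (+-∸-assoc a i≤d) ⟩
  f (a + (d ∸ i))   ≡⟨ pal (d ∸ i) i (trans (+-suc (d ∸ i) i) (cong suc (m∸n+n≡m i≤d))) ⟩
  f (a + i)         ∎

Palindromic-inner : ∀ f a {c} → Palindromic f a (suc (suc c)) → Palindromic f (suc a) c
Palindromic-inner f a pal i i′ eq = begin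
  f (suc a + i)   ≡⟨ cong f (+-suc a i) ⟨
  f (a + suc i)   ≡⟨ pal (suc i) (suc i′) (cong suc (trans (+-suc i (suc i′)) (cong suc eq))) ⟩
  f (a + suc i′)  ≡⟨ cong f (+-suc a i′) ⟩
  f (suc a + i′)  ∎

Palindromic-ends : ∀ f a {c} → Palindromic f a (suc (suc c)) → f (suc a + c) ≡ f a
Palindromic-ends f a {c} pal = begin
  f (suc a + c)   ≡⟨ cong f (+-suc a c) ⟨
  f (a + suc c)   ≡⟨ pal 0 (suc c) refl ⟨
  f (a + 0)       ≡⟨ cong f (+-identityʳ a) ⟩
  f a             ∎

-- The middle stretch m is written first in the length so that m = 0 and
-- m = 1 give t + t and suc (t + t) on the nose.
sumFrom-palindromic : ∀ f a m t → Palindromic f a (m + (t + t)) →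
  sumFrom f a (m + (t + t)) ≡ 2 * sumFrom f a t + sumFrom f (a + t) m
sumFrom-palindromic f a m zero    _   = cong₂ (sumFrom f) (sym (+-identityʳ a)) (+-identityʳ m)
sumFrom-palindromic f a m (suc t) pal = begin
  sumFrom f a (m + (suc t + suc t))
    ≡⟨ cong (sumFrom f a) (shape m t) ⟩
  f a + sumFrom f (suc a) (suc c)
    ≡⟨ cong (f a +_) (sumFrom-last f (suc a) c) ⟩
  f a + (sumFrom f (suc a) c + f (suc a + c))
    ≡⟨ cong (λ x → f a + (sumFrom f (suc a) c + x)) (Palindromic-ends f a pal′) ⟩
  f a + (sumFrom f (suc a) c + f a)
    ≡⟨ cong (λ x → f a + (x + f a)) (sumFrom-palindromic f (suc a) m t (Palindromic-inner f a pal′)) ⟩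
  f a + (2 * sumFrom f (suc a) t + sumFrom f (suc a + t) m + f a)
    ≡⟨ regroup (f a) (sumFrom f (suc a) t) (sumFrom f (suc a + t) m) ⟩
  2 * (f a + sumFrom f (suc a) t) + sumFrom f (suc a + t) m
    ≡⟨ cong (λ x → 2 * sumFrom f a (suc t) + sumFrom f x m) (+-suc a t) ⟨
  2 * sumFrom f a (suc t) + sumFrom f (a + suc t) m
    ∎
  where
  c = m + (t + t)
  shape : ∀ m t → m + (suc t + suc t) ≡ suc (suc (m + (t + t)))
  shape = solve-∀
  regroup : ∀ x s r → x + (2 * s + r + x) ≡ 2 * (x + s) + r
  regroup = solve-∀
  pal′ : Palindromic f a (suc (suc c))
  pal′ = subst (Palindromic f a) (shape m t) pal

sumFrom-palindromic-%2 : ∀ f a {c} m t → c ≡ m + (t + t) → Palindromic f a c →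
  sumFrom f a c % 2 ≡ sumFrom f (a + t) m % 2
sumFrom-palindromic-%2 f a m t refl pal = begin
  sumFrom f a (m + (t + t)) % 2                   ≡⟨ cong (_% 2) (sumFrom-palindromic f a m t pal) ⟩
  (2 * sumFrom f a t + sumFrom f (a + t) m) % 2   ≡⟨ %-remove-+ˡ _ (m∣m*n (sumFrom f a t)) ⟩
  sumFrom f (a + t) m % 2                         ∎

sumFrom-palindromic-even : ∀ f a d → Palindromic f a (suc d) →
  Even (d + 1) ⊎ (Odd (d + 1) × Even (f (a + d / 2))) → Even (sumFrom f a (suc d))
sumFrom-palindromic-even f a d pal (inj₁ even) =
  sumFrom-palindromic-%2 f a 0 (suc d / 2) (even⇒≡half+half (suc d) (subst Even (+-comm d 1) even)) pal
sumFrom-palindromic-even f a d pal (inj₂ (odd , middle-even)) = begin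
  sumFrom f a (suc d) % 2      ≡⟨ sumFrom-palindromic-%2 f a 1 (d / 2) (cong suc d≡t+t) pal ⟩
  (f (a + d / 2) + 0) % 2      ≡⟨ cong (_% 2) (+-identityʳ (f (a + d / 2))) ⟩
  f (a + d / 2) % 2            ≡⟨ middle-even ⟩
  0                            ∎
  where
  d≡t+t : d ≡ d / 2 + d / 2
  d≡t+t = even⇒≡half+half d (odd⇒pred-even (suc d) (subst Odd (+-comm d 1) odd))

nth-map-applyUpTo : ∀ (h g : ℕ → ℕ) n m → m < n → nth (map h (applyUpTo g n)) (suc m) ≡ h (g m)
nth-map-applyUpTo h g (suc n) zero    _         = refl
nth-map-applyUpTo h g (suc n) (suc m) (s≤s m<n) = nth-map-applyUpTo h (g ∘ suc) n m m<n

All-nth : ∀ {P : ℕ → Set} {L} i → All P L → 1 ≤ i → i ≤ length L → P (nth L i)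
All-nth (suc zero)    (p ∷ _)  _ _         = p
All-nth (suc (suc i)) (_ ∷ ps) _ (s≤s i<n) = All-nth (suc i) ps (s≤s z≤n) i<n

len-reflect : ∀ B {j k m} → ρ j k B ≡ B → j ≤ suc m → suc m ≤ k → k ≤ nB B →
  len B (suc m) ≡ len B (k + j ∸ suc m)
len-reflect B {j} {k} {m} ρB≡B j≤1+m 1+m≤k k≤n = begin
  len B (suc m)
    ≡⟨ cong (λ B′ → len B′ (suc m)) ρB≡B ⟨
  len (ρ j k B) (suc m)
    ≡⟨ nth-map-applyUpTo _ id (nB B) m (≤-trans 1+m≤k k≤n) ⟩
  (if (j ≤ᵇ suc m) ∧ (suc m ≤ᵇ k) then len B (k + j ∸ suc m) else len B (suc m))
    ≡⟨ cong (λ b → if b then len B (k + j ∸ suc m) else len B (suc m))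
            (cong₂ _∧_ (≤ᵇ-true j≤1+m) (≤ᵇ-true 1+m≤k)) ⟩
  len B (k + j ∸ suc m)
    ∎
  where
  ≤ᵇ-true : ∀ {p q} → p ≤ q → (p ≤ᵇ q) ≡ true
  ≤ᵇ-true = Equivalence.to T-≡ ∘ ≤⇒≤ᵇ

len-palindromic : ∀ B {j k} → 1 ≤ j → j ≤ k → k ≤ nB B → ρ j k B ≡ B →
  Palindromic (len B) j (suc (k ∸ j))
len-palindromic B {suc j′} {k} _ j≤k k≤n ρB≡B i i′ i+1+i′≡ = begin
  len B (j + i)                          ≡⟨ len-reflect B ρB≡B (m≤m+n j i) j+i≤k k≤n ⟩
  len B (k + j ∸ (j + i))                ≡⟨ cong (λ x → len B (x + j ∸ (j + i))) k≡ ⟩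
  len B (j + (i + i′) + j ∸ (j + i))     ≡⟨ cong (λ x → len B (x ∸ (j + i))) (regroup j i i′) ⟩
  len B ((j + i) + (j + i′) ∸ (j + i))   ≡⟨ cong (len B) (m+n∸m≡n (j + i) (j + i′)) ⟩
  len B (j + i′)                         ∎
  where
  j = suc j′
  k≡ : k ≡ j + (i + i′)
  k≡ = trans (sym (m+[n∸m]≡n j≤k)) (cong (j +_) (sym (suc-injective (trans (sym (+-suc i i′)) i+1+i′≡))))
  j+i≤k : j + i ≤ k
  j+i≤k = subst (j + i ≤_) (sym k≡) (+-monoʳ-≤ j (m≤m+n i i′))
  regroup : ∀ j i i′ → j + (i + i′) + j ≡ (j + i) + (j + i′)
  regroup = solve-∀

startAux-step : ∀ e (L : List ℕ) i → i < length L →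
  startAux e L (suc (suc i)) ≡ (startAux e L (suc i) + nth L (suc i) ∸ 1) % 2
startAux-step e (l ∷ [])     zero    _         = refl
startAux-step e (l ∷ _ ∷ _)  zero    _         = refl
startAux-step e (l ∷ [])     (suc i) (s≤s ())
startAux-step e (l ∷ l′ ∷ L) (suc i) (s≤s i<n) = startAux-step ((e + l ∸ 1) % 2) (l′ ∷ L) i i<n

startAux<2 : ∀ e L i → e < 2 → startAux e L i < 2
startAux<2 e []      i             e<2 = e<2
startAux<2 e (_ ∷ _) zero          e<2 = e<2
startAux<2 e (_ ∷ _) (suc zero)    e<2 = e<2
startAux<2 e (l ∷ L) (suc (suc i)) _   = startAux<2 _ L (suc i) (m%n<n (e + l ∸ 1) 2)

st-suc≡en : ∀ B i → 1 ≤ i → i < nB B → st B (suc i) ≡ en B i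
st-suc≡en B (suc i) _ i<n = startAux-step (ε₁ B) (lens B) i (<⇒≤ i<n)

flips : BlockDecomp → ℕ → ℕ
flips B i = len B i ∸ 1

en≡st+flips : ∀ B i → All (1 ≤_) (lens B) → 1 ≤ i → i ≤ nB B → en B i ≡ (st B i + flips B i) % 2
en≡st+flips B i lens≥1 1≤i i≤n = cong (_% 2) (+-∸-assoc (st B i) (All-nth i lens≥1 1≤i i≤n))

en≡st+sumFrom-flips : ∀ B {j} d → All (1 ≤_) (lens B) → 1 ≤ j → j + d ≤ nB B →
  en B (j + d) ≡ (st B j + sumFrom (flips B) j (suc d)) % 2
en≡st+sumFrom-flips B {j} zero lens≥1 1≤j j+0≤n = begin
  en B (j + 0)                     ≡⟨ cong (en B) (+-identityʳ j) ⟩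
  en B j                           ≡⟨ en≡st+flips B j lens≥1 1≤j (subst (_≤ nB B) (+-identityʳ j) j+0≤n) ⟩
  (st B j + flips B j) % 2         ≡⟨ cong (λ x → (st B j + x) % 2) (+-identityʳ (flips B j)) ⟨
  (st B j + (flips B j + 0)) % 2   ∎
en≡st+sumFrom-flips B {j} (suc d) lens≥1 1≤j j+d<n = begin
  en B (j + suc d)                         ≡⟨ cong (en B) (+-suc j d) ⟩
  en B (suc j + d)                         ≡⟨ en≡st+sumFrom-flips B d lens≥1 (s≤s z≤n) 1+j+d≤n ⟩
  (st B (suc j) + rest) % 2                ≡⟨ cong (λ x → (x + rest) % 2) (st-suc≡en B j 1≤j j<n) ⟩
  (en B j + rest) % 2                      ≡⟨ cong (λ x → (x + rest) % 2) (en≡st+flips B j lens≥1 1≤j (<⇒≤ j<n)) ⟩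
  ((st B j + flips B j) % 2 + rest) % 2    ≡⟨ [m%d+n]%d≡[m+n]%d (st B j + flips B j) rest 2 ⟩
  (st B j + flips B j + rest) % 2          ≡⟨ cong (_% 2) (+-assoc (st B j) (flips B j) rest) ⟩
  (st B j + (flips B j + rest)) % 2        ∎
  where
  rest = sumFrom (flips B) (suc j) (suc d)
  1+j+d≤n : suc j + d ≤ nB B
  1+j+d≤n = subst (_≤ nB B) (+-suc j d) j+d<n
  j<n : j < nB B
  j<n = m+n≤o⇒m≤o (suc j) 1+j+d≤n

lemma5p1 : (B : BlockDecomp) → Valid B → (j k : ℕ) → 1 ≤ j → j ≤ k → k ≤ nB B →
    ρ j k B ≡ B →
    ((i : ℕ) → i ≤ k ∸ j → len B (k ∸ i) ≡ len B (j + i))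
    × ((Even (k ∸ j + 1) ⊎ (Odd (k ∸ j + 1) × Odd (len B (j + (k ∸ j) / 2))))
       → st B j ≡ en B k)
lemma5p1 B (ε₁<2 , lens≥1) j k 1≤j j≤k k≤n ρB≡B = mirror , st≡en
  where
  d = k ∸ j
  j+d≡k : j + d ≡ k
  j+d≡k = m+[n∸m]≡n j≤k
  pal : Palindromic (len B) j (suc d)
  pal = len-palindromic B 1≤j j≤k k≤n ρB≡B

  mirror : (i : ℕ) → i ≤ d → len B (k ∸ i) ≡ len B (j + i)
  mirror i i≤d = subst (λ x → len B (x ∸ i) ≡ len B (j + i)) j+d≡k (Palindromic-reverse (len B) j pal i≤d)

  st≡en : Even (d + 1) ⊎ (Odd (d + 1) × Odd (len B (j + d / 2))) → st B j ≡ en B k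
  st≡en parity = begin
    st B j                                       ≡⟨ m<n⇒m%n≡m (startAux<2 (ε₁ B) (lens B) j ε₁<2) ⟨
    st B j % 2                                   ≡⟨ %-remove-+ʳ (st B j) (m%n≡0⇒n∣m _ 2 flips-even) ⟨
    (st B j + sumFrom (flips B) j (suc d)) % 2   ≡⟨ en≡st+sumFrom-flips B d lens≥1 1≤j (subst (_≤ nB B) (sym j+d≡k) k≤n) ⟨
    en B (j + d)                                 ≡⟨ cong (en B) j+d≡k ⟩
    en B k                                       ∎
    where
    flips-even : Even (sumFrom (flips B) j (suc d))
    flips-even = sumFrom-palindromic-even (flips B) j d (Palindromic-map (_∸ 1) (len B) j pal)
                   (Sum.map₂ (Product.map₂ (odd⇒pred-even (len B (j + d / 2)))) parity)
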